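{- Suppose that for every $n\ge 3$, $$\sum_{\substack{n/5\le k\le n\\ k\text{ even}}} r(n,k)\equiv \sum_{\substack{n/5\le k\le n\\ k\text{ odd}}} r(n,k)\equiv 0 \pmod 5.$$ Then $d(n)\equiv(-1)^{n+1}\pmod 5$ for all $n\ge 1$.
   Context: Define integer sequences $u,v$ by $u(0)=v(0)=1$ and, for $n\ge 1$, $u(n)=\Big(\prod_{j=1}^{n}(4j-1)\Big)^2-\sum_{m=0}^{n-1}\binom{2n+1}{2m+1}\Big(\prod_{j=1}^{n-m}(4j-3)\Big)^2u(m)$ and $v(n)=2^{n-1}\Big(\prod_{j=1}^{n}(4j-3)\Big)^2-\frac12\sum_{m=1}^{n-1}\binom{2n}{2m}v(m)v(n-m)$. For $1\le k\le n$, $s(n,k)=\frac{(2n)!}{(2k)!}[z^{2n}]\Big(\sum_{j\ge0}\frac{u(j)}{(2j+1)!}z^{2j+1}\Big)^{2k}$ and $r(n,k)=2^{n-k}s(n,k)$ (integers). The Romik sequence: with $\theta_3(x)=1+2\sum_{n\ge1}e^{ -\pi n^2x}$ ($\mathrm{Re}\,x>0$), $\sigma(z)=(1+z)^{ -1/2}\theta_3\!\left(\frac{1-z}{1+z}\right)$ on the unit disk, $\Phi=\frac{\Gamma(1/4)^8}{128\pi^4}$, $A=\theta_3(1)$, set $d(n)=\sigma^{(2n)}(0)/(A\Phi^n)$. It is known (Romik) that the $d(n)$ are integers, $d(0)=1$, and $d(n)=v(n)-\sum_{k=1}^{n-1}r(n,k)d(k)$ for $n\ge1$. -}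

module Defs where

open import Data.Bool using (Bool; true; false; if_then_else_; _∧_)
open import Data.Nat as ℕ using (ℕ; zero; suc; _∸_; _≤ᵇ_; _≡ᵇ_; _%_)
open import Data.Nat.Combinatorics using (_C_)
open import Data.Nat.Base using (_!)
open import Data.Nat.Properties using (_!≢0)
open import Data.Integer using (ℤ; +_; -[1+_]; _+_; _-_; _*_; _^_; _/_)
open import Data.Integer.Divisibility using (_∣_)

σ : ℕ → (ℕ → ℤ) → ℤ
σ zero    f = + 0
σ (suc n) f = σ n f + f n

-- Σ[ a to b ] f = Σ_{m=a}^{b} f m   (empty if b < a)
Σ[_to_] : ℕ → ℕ → (ℕ → ℤ) → ℤ
Σ[ a to b ] f = σ (suc b ∸ a) (λ i → f (a ℕ.+ i))

Π[1to_] : ℕ → (ℕ → ℤ) → ℤ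
Π[1to zero  ] f = + 1
Π[1to suc n ] f = Π[1to n ] f * f (suc n)

-- Course-of-values recursion: `cov step n` computes a(n) where
-- a(n) = step n a, and `step n a` only inspects a(m) for m < n.

private
  table : (ℕ → (ℕ → ℤ) → ℤ) → ℕ → (ℕ → ℤ)
  table step zero    = λ _ → step 0 (λ _ → + 0)
  table step (suc n) = λ m → if m ≤ᵇ n then table step n m
                             else step (suc n) (table step n)

cov : (ℕ → (ℕ → ℤ) → ℤ) → ℕ → ℤ
cov step n = table step n n

ℤ[_] : ℕ → ℤ
ℤ[ n ] = + n

uStep : ℕ → (ℕ → ℤ) → ℤ
uStep zero    _ = + 1
uStep (suc p) u =
  let n = suc p in
  (Π[1to n ] (λ j → + (4 ℕ.* j ∸ 1))) ^ 2
  - Σ[ 0 to p ] (λ m →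
      ℤ[ (2 ℕ.* n ℕ.+ 1) C (2 ℕ.* m ℕ.+ 1) ]
      * (Π[1to n ∸ m ] (λ j → + (4 ℕ.* j ∸ 3))) ^ 2
      * u m)

u : ℕ → ℤ
u = cov uStep

-- (1/2)·S is computed as the (exact) integer quotient S / 2.
vStep : ℕ → (ℕ → ℤ) → ℤ
vStep zero    _ = + 1
vStep (suc p) v =
  let n = suc p in
  (+ 2) ^ p * (Π[1to n ] (λ j → + (4 ℕ.* j ∸ 3))) ^ 2
  - (Σ[ 1 to p ] (λ m → ℤ[ (2 ℕ.* n) C (2 ℕ.* m) ] * v m * v (n ∸ m))) / (+ 2)

v : ℕ → ℤ
v = cov vStep

-- s(n,k) = (2n)!/(2k)! [z^{2n}] U(z)^{2k},  U(z) = Σ_j u(j) z^{2j+1}/(2j+1)!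
-- Exponential generating functions are represented by their sequences of
-- "EGF coefficients" a_m = m! [z^m] A(z); the product of EGFs corresponds
-- to the binomial convolution.

Ucoef : ℕ → ℤ
Ucoef m = if m % 2 ≡ᵇ 0 then + 0 else u (m ℕ./ 2)

conv : (ℕ → ℤ) → (ℕ → ℤ) → ℕ → ℤ
conv a b n = Σ[ 0 to n ] (λ i → ℤ[ n C i ] * a i * b (n ∸ i))

egfPow : (ℕ → ℤ) → ℕ → ℕ → ℤ
egfPow a zero    m = if m ≡ᵇ 0 then + 1 else + 0
egfPow a (suc k) m = conv a (egfPow a k) m

s : ℕ → ℕ → ℤ
s n k = _/_ (egfPow Ucoef (2 ℕ.* k) (2 ℕ.* n)) ℤ[ (2 ℕ.* k) ! ] {{(2 ℕ.* k) !≢0}}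

r : ℕ → ℕ → ℤ
r n k = (+ 2) ^ (n ∸ k) * s n k

dStep : ℕ → (ℕ → ℤ) → ℤ
dStep zero    _ = + 1
dStep (suc p) d = v (suc p) - Σ[ 1 to p ] (λ k → r (suc p) k * d k)

d : ℕ → ℤ
d = cov dStep

-- The sums in the hypothesis: Σ over n/5 ≤ k ≤ n with k of given parity
-- (k ≥ n/5 is written 5k ≥ n; parity given by k % 2 ≡ᵇ e, e ∈ {0,1})

rParitySum : ℕ → ℕ → ℤ
rParitySum e n = Σ[ 0 to n ] (λ k →
  if (n ≤ᵇ 5 ℕ.* k) ∧ (k % 2 ≡ᵇ e) then r n k else + 0)

_≡_[mod5] : ℤ → ℤ → Set
a ≡ b [mod5] = + 5 ∣ (a - b)

{-# OPTIONS --safe #-}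
-- Modulo 5, u(n) ≡ v(n) ≡ 0 for n ≥ 3 by strong induction: the products ∏(4j−1) (from n = 4)
-- and ∏(4j−3) (from n = 2) contain the factors 15 and 5, and every remaining term of the
-- recurrences contains an earlier u(m) or v(m) with m ≥ 3; the first cases are computed.
-- So U(z) = Σ u(j) z^(2j+1)/(2j+1)! is congruent to a polynomial of degree 5, and the divided
-- power U^K/K! (integral, by the product rule (U^(K+1)/(K+1)!)′ = U′ · U^K/K!) has no terms of
-- degree above 5K: r(n,k) ≡ 0 whenever 5k < n, while r(n,n) = 1. The hypothesis thus says
-- Σ_{k ≤ n} (−1)^(k+1) r(n,k) ≡ 0 for n ≥ 3, and inserting d(k) ≡ (−1)^(k+1) for 0 < k < n into
-- d(n) = v(n) − Σ_{0<k<n} r(n,k) d(k) leaves d(n) ≡ (−1)^(n+1).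
module Submission where

open import Defs
open import Data.Bool using (true; false; if_then_else_; _∧_)
open import Data.Empty using (⊥-elim)
open import Data.Integer
  using (ℤ; +_; -[1+_]; _+_; _-_; _*_; _^_; _/_; _%_)
open import Data.Integer.Coprimality using (coprime?; coprime-divisor)
open import Data.Integer.DivMod using (a≡a%n+[a/n]*n; n%d<d)
open import Data.Integer.Divisibility.Signed
  using ( _∣_; divides; ∣ᵤ⇒∣; ∣⇒∣ᵤ; ∣m∣n⇒∣m+n; ∣m∣n⇒∣m-n; ∣m⇒∣-m
        ; ∣m+n∣m⇒∣n; ∣m+n∣n⇒∣m; ∣m⇒∣m*n; ∣n⇒∣m*n )
import Data.Integer.Properties as ℤP
open import Data.Integer.Tactic.RingSolver using (solve-∀)
open import Data.Nat as ℕ using (ℕ; zero; suc; _∸_; _≤_; _<_; z≤n; s≤s; _≤ᵇ_; _!)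
import Data.Nat.Properties as ℕP
open import Data.Nat.Combinatorics using (_C_; nCk+nC[k+1]≡[n+1]C[k+1]; nCk≡nC[n∸k]; k>n⇒nCk≡0)
open import Data.Nat.DivMod using (/-monoˡ-≤)
open import Data.Nat.Induction using (<-rec)
open import Data.Product using (_×_; _,_)
open import Data.Sum using (_⊎_; inj₁; inj₂)
open import Relation.Binary.PropositionalEquality
open import Relation.Nullary using (yes; no)
open import Relation.Nullary.Decidable using (dec-false; from-yes)
open import Relation.Nullary.Reflects using (ofʸ; ofⁿ)

σ-cong : ∀ n {f g : ℕ → ℤ} → (∀ i → i < n → f i ≡ g i) → σ n f ≡ σ n g
σ-cong zero    f≗g = refl
σ-cong (suc n) f≗g =
  cong₂ _+_ (σ-cong n (λ i i<n → f≗g i (ℕP.m<n⇒m<1+n i<n))) (f≗g n ℕP.≤-refl)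

σ-zero : ∀ n {f : ℕ → ℤ} → (∀ i → i < n → f i ≡ + 0) → σ n f ≡ + 0
σ-zero zero    f≗0 = refl
σ-zero (suc n) f≗0 =
  cong₂ _+_ (σ-zero n (λ i i<n → f≗0 i (ℕP.m<n⇒m<1+n i<n))) (f≗0 n ℕP.≤-refl)

σ-head : ∀ n (f : ℕ → ℤ) → σ (suc n) f ≡ f 0 + σ n (λ i → f (suc i))
σ-head zero    f = ℤP.+-comm (+ 0) (f 0)
σ-head (suc n) f =
  trans (cong (_+ f (suc n)) (σ-head n f)) (ℤP.+-assoc (f 0) (σ n (λ i → f (suc i))) (f (suc n)))

σ-distrib-+ : ∀ n (f g : ℕ → ℤ) → σ n (λ i → f i + g i) ≡ σ n f + σ n g
σ-distrib-+ zero    f g = refl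
σ-distrib-+ (suc n) f g =
  trans (cong (_+ (f n + g n)) (σ-distrib-+ n f g)) (interchange (σ n f) (σ n g) (f n) (g n))
  where
  interchange : ∀ a b c d → a + b + (c + d) ≡ a + c + (b + d)
  interchange = solve-∀

*-distribˡ-σ : ∀ n c (f : ℕ → ℤ) → c * σ n f ≡ σ n (λ i → c * f i)
*-distribˡ-σ zero    c f = ℤP.*-zeroʳ c
*-distribˡ-σ (suc n) c f =
  trans (ℤP.*-distribˡ-+ c (σ n f) (f n)) (cong (_+ c * f n) (*-distribˡ-σ n c f))

∣fᵢ⇒∣σf : ∀ {k} n {f : ℕ → ℤ} → (∀ i → i < n → k ∣ f i) → k ∣ σ n f
∣fᵢ⇒∣σf zero    k∣f = divides (+ 0) refl
∣fᵢ⇒∣σf (suc n) k∣f =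
  ∣m∣n⇒∣m+n (∣fᵢ⇒∣σf n (λ i i<n → k∣f i (ℕP.m<n⇒m<1+n i<n))) (k∣f n ℕP.≤-refl)

∣fᵢ-gᵢ⇒∣σf-σg : ∀ {k} n {f g : ℕ → ℤ} →
  (∀ i → i < n → k ∣ f i - g i) → k ∣ σ n f - σ n g
∣fᵢ-gᵢ⇒∣σf-σg zero    k∣f-g = divides (+ 0) refl
∣fᵢ-gᵢ⇒∣σf-σg {k} (suc n) {f} {g} k∣f-g =
  subst (k ∣_) (regroup (σ n f) (σ n g) (f n) (g n))
    (∣m∣n⇒∣m+n (∣fᵢ-gᵢ⇒∣σf-σg n (λ i i<n → k∣f-g i (ℕP.m<n⇒m<1+n i<n)))
               (k∣f-g n ℕP.≤-refl))
  where
  regroup : ∀ a b c d → a - b + (c - d) ≡ a + c - (b + d)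
  regroup = solve-∀

-- The table behind `cov` is private to Defs: it is abstracted here as any `tb` obeying its
-- defining equation, and `cov-suc` recovers it by unification (so `diagonal` has no signature).
table-diagonal : (step : ℕ → (ℕ → ℤ) → ℤ) (tb : ℕ → ℕ → ℤ) →
  (∀ n m → tb (suc n) m ≡ (if m ≤ᵇ n then tb n m else step (suc n) (tb n))) →
  ∀ n m → m ≤ n → tb n m ≡ tb m m
table-diagonal step tb tb-suc zero    zero z≤n   = refl
table-diagonal step tb tb-suc (suc n) m    m≤1+n with m ≤ᵇ n | ℕP.≤ᵇ-reflects-≤ m n | tb-suc n m
... | true  | ofʸ m≤n | eq = trans eq (table-diagonal step tb tb-suc n m m≤n)
... | false | ofⁿ m≰n | _  rewrite ℕP.≤-antisym m≤1+n (ℕP.≰⇒> m≰n) = refl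

if-false : ∀ {A : Set} {b} {x y : A} → b ≡ false → (if b then x else y) ≡ y
if-false refl = refl

cov-suc : ∀ step →
  (∀ p f g → (∀ m → m < suc p → f m ≡ g m) → step (suc p) f ≡ step (suc p) g) →
  ∀ p → cov step (suc p) ≡ step (suc p) (cov step)
cov-suc step step-ext = λ p →
  trans (if-false (dec-false (suc p ℕ.≤? p) (ℕP.n≮n p)))
        (step-ext p _ _ (λ m m<1+p → diagonal p m (ℕP.≤-pred m<1+p)))
  where
  diagonal = table-diagonal step _ (λ _ _ → refl)

-- (n − q) · m is the remainder of m · n, which lies in [0, m); hence n − q = 0.
m*n/m≡n : ∀ m n .{{_ : ℕ.NonZero m}} → (+ m * n) / + m ≡ n
m*n/m≡n m@(suc _) n = sym (ℤP.i-j≡0⇒i≡j n q (difference≡0 (n - q) remainder-eq (n%d<d (+ m * n) (+ m))))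
  where
  q : ℤ
  q = (+ m * n) / + m
  ρ : ℕ
  ρ = (+ m * n) % + m
  remainder-eq : (n - q) * + m ≡ + ρ
  remainder-eq = begin
    (n - q) * + m           ≡⟨ expand n q (+ m) ⟩
    + m * n - q * + m       ≡⟨ cong (_- q * + m) (a≡a%n+[a/n]*n (+ m * n) (+ m)) ⟩
    + ρ + q * + m - q * + m ≡⟨ cancel (+ ρ) (q * + m) ⟩
    + ρ                     ∎
    where
    open ≡-Reasoning
    expand : ∀ n q m → (n - q) * m ≡ m * n - q * m
    expand = solve-∀
    cancel : ∀ r x → r + x - x ≡ r
    cancel = solve-∀
  difference≡0 : ∀ k → k * + m ≡ + ρ → ρ < m → k ≡ + 0
  difference≡0 (+ zero)  _  _   = refl
  difference≡0 (+ suc k) eq ρ<m =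
    ⊥-elim (ℕP.<⇒≱ ρ<m (subst (m ≤_) (ℤP.+-injective (trans (ℤP.pos-* (suc k) m) eq))
                                    (ℕP.m≤m+n m (k ℕ.* m))))
  difference≡0 -[1+ k ] () _

∂ : (ℕ → ℤ) → ℕ → ℤ
∂ a i = a (suc i)

conv-congʳ : ∀ a {b b′ : ℕ → ℤ} → (∀ j → b j ≡ b′ j) → ∀ m → conv a b m ≡ conv a b′ m
conv-congʳ a b≗b′ m = σ-cong (suc m) (λ i _ → cong (+ (m C i) * a i *_) (b≗b′ (m ∸ i)))

conv-distribˡ-+ : ∀ a b c m → conv a (λ j → b j + c j) m ≡ conv a b m + conv a c m
conv-distribˡ-+ a b c m =
  trans (σ-cong (suc m) (λ i _ → ℤP.*-distribˡ-+ (+ (m C i) * a i) (b (m ∸ i)) (c (m ∸ i))))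
        (σ-distrib-+ (suc m) _ _)

conv-*ʳ : ∀ a b c m → conv a (λ j → c * b j) m ≡ c * conv a b m
conv-*ʳ a b c m =
  trans (σ-cong (suc m) (λ i _ → pull (+ (m C i) * a i) c (b (m ∸ i))))
        (sym (*-distribˡ-σ (suc m) c _))
  where
  pull : ∀ x c y → x * (c * y) ≡ c * (x * y)
  pull = solve-∀

conv-zeroʳ : ∀ a m → conv a (λ _ → + 0) m ≡ + 0
conv-zeroʳ a m = σ-zero (suc m) (λ i _ → ℤP.*-zeroʳ (+ (m C i) * a i))

conv-leibniz : ∀ a b m → conv a b (suc m) ≡ conv (∂ a) b m + conv a (∂ b) m
conv-leibniz a b m = begin
  conv a b (suc m)                   ≡⟨ σ-head (suc m) F ⟩
  F 0 + σ (suc m) (λ i → F (suc i)) ≡⟨ cong (_+_ (F 0)) tail-split ⟩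
  F 0 + (conv (∂ a) b m + σ m G)     ≡⟨ x+[y+z]≡y+[x+z] (F 0) (conv (∂ a) b m) (σ m G) ⟩
  conv (∂ a) b m + (F 0 + σ m G)     ≡⟨ cong (_+_ (conv (∂ a) b m)) ∂b-split ⟨
  conv (∂ a) b m + conv a (∂ b) m    ∎
  where
  open ≡-Reasoning
  F P G : ℕ → ℤ
  F i = + (suc m C i) * a i * b (suc m ∸ i)
  P i = + (m C i) * a (suc i) * b (m ∸ i)
  G i = + (m C suc i) * a (suc i) * b (m ∸ i)
  x+[y+z]≡y+[x+z] : ∀ x y z → x + (y + z) ≡ y + (x + z)
  x+[y+z]≡y+[x+z] = solve-∀
  distribʳ : ∀ x y p q → (x + y) * p * q ≡ x * p * q + y * p * q
  distribʳ = solve-∀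
  pascal : ∀ i → F (suc i) ≡ P i + G i
  pascal i = begin
    + (suc m C suc i) * a (suc i) * b (m ∸ i)
      ≡⟨ cong (λ c → + c * a (suc i) * b (m ∸ i)) (sym (nCk+nC[k+1]≡[n+1]C[k+1] m i)) ⟩
    + (m C i ℕ.+ m C suc i) * a (suc i) * b (m ∸ i)
      ≡⟨ cong (λ c → c * a (suc i) * b (m ∸ i)) (ℤP.pos-+ (m C i) (m C suc i)) ⟩
    (+ (m C i) + + (m C suc i)) * a (suc i) * b (m ∸ i)
      ≡⟨ distribʳ (+ (m C i)) (+ (m C suc i)) (a (suc i)) (b (m ∸ i)) ⟩
    P i + G i ∎
  G-last≡0 : G m ≡ + 0
  G-last≡0 = cong (λ c → + c * a (suc m) * b (m ∸ m)) (k>n⇒nCk≡0 (ℕP.n<1+n m))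
  tail-split : σ (suc m) (λ i → F (suc i)) ≡ conv (∂ a) b m + σ m G
  tail-split = begin
    σ (suc m) (λ i → F (suc i))           ≡⟨ σ-cong (suc m) (λ i _ → pascal i) ⟩
    σ (suc m) (λ i → P i + G i)           ≡⟨ σ-distrib-+ (suc m) P G ⟩
    conv (∂ a) b m + (σ m G + G m)        ≡⟨ cong (λ g → conv (∂ a) b m + (σ m G + g)) G-last≡0 ⟩
    conv (∂ a) b m + (σ m G + + 0)        ≡⟨ cong (_+_ (conv (∂ a) b m)) (ℤP.+-identityʳ (σ m G)) ⟩
    conv (∂ a) b m + σ m G                ∎
  ∂b-split : conv a (∂ b) m ≡ F 0 + σ m G
  ∂b-split = trans (σ-head m (λ i → + (m C i) * a i * b (suc (m ∸ i))))
    (cong (_+_ (F 0)) (σ-cong m (λ i i<m → cong (λ j → G′ i * b j) (sym (ℕP.+-∸-assoc 1 i<m)))))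
    where
    G′ : ℕ → ℤ
    G′ i = + (m C suc i) * a (suc i)

conv-∂ʳ : ∀ a b c m → conv a (∂ (conv b c)) m ≡ conv a (conv (∂ b) c) m + conv a (conv b (∂ c)) m
conv-∂ʳ a b c m =
  trans (conv-congʳ a (conv-leibniz b c) m) (conv-distribˡ-+ a (conv (∂ b) c) (conv b (∂ c)) m)

conv-leftComm : ∀ a b c m → conv a (conv b c) m ≡ conv b (conv a c) m
conv-leftComm a b c zero = x[yz]≡y[xz] (a 0) (b 0) (c 0)
  where
  x[yz]≡y[xz] : ∀ x y z → + 0 + + 1 * x * (+ 0 + + 1 * y * z) ≡ + 0 + + 1 * y * (+ 0 + + 1 * x * z)
  x[yz]≡y[xz] = solve-∀
conv-leftComm a b c (suc m) = begin
  conv a (conv b c) (suc m)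
    ≡⟨ conv-leibniz a (conv b c) m ⟩
  conv (∂ a) (conv b c) m + conv a (∂ (conv b c)) m
    ≡⟨ cong (_+_ (conv (∂ a) (conv b c) m)) (conv-∂ʳ a b c m) ⟩
  conv (∂ a) (conv b c) m + (conv a (conv (∂ b) c) m + conv a (conv b (∂ c)) m)
    ≡⟨ cong₂ _+_ (conv-leftComm (∂ a) b c m)
                 (cong₂ _+_ (conv-leftComm a (∂ b) c m) (conv-leftComm a b (∂ c) m)) ⟩
  conv b (conv (∂ a) c) m + (conv (∂ b) (conv a c) m + conv b (conv a (∂ c)) m)
    ≡⟨ x+[y+z]≡y+[x+z] (conv b (conv (∂ a) c) m) (conv (∂ b) (conv a c) m) (conv b (conv a (∂ c)) m) ⟩
  conv (∂ b) (conv a c) m + (conv b (conv (∂ a) c) m + conv b (conv a (∂ c)) m)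
    ≡⟨ cong (_+_ (conv (∂ b) (conv a c) m)) (conv-∂ʳ b a c m) ⟨
  conv (∂ b) (conv a c) m + conv b (∂ (conv a c)) m
    ≡⟨ conv-leibniz b (conv a c) m ⟨
  conv b (conv a c) (suc m) ∎
  where
  open ≡-Reasoning
  x+[y+z]≡y+[x+z] : ∀ x y z → x + (y + z) ≡ y + (x + z)
  x+[y+z]≡y+[x+z] = solve-∀

egfPow-∂ : ∀ a K m → ∂ (egfPow a (suc K)) m ≡ + suc K * conv (∂ a) (egfPow a K) m
egfPow-∂ a zero m = begin
  conv a E₀ (suc m)                       ≡⟨ conv-leibniz a E₀ m ⟩
  conv (∂ a) E₀ m + conv a (λ _ → + 0) m  ≡⟨ cong (_+_ (conv (∂ a) E₀ m)) (conv-zeroʳ a m) ⟩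
  conv (∂ a) E₀ m + + 0                   ≡⟨ x+0≡1*x (conv (∂ a) E₀ m) ⟩
  + 1 * conv (∂ a) E₀ m                   ∎
  where
  open ≡-Reasoning
  E₀ : ℕ → ℤ
  E₀ = egfPow a 0
  x+0≡1*x : ∀ x → x + + 0 ≡ + 1 * x
  x+0≡1*x = solve-∀
egfPow-∂ a (suc K) m = begin
  conv a E₁ (suc m)
    ≡⟨ conv-leibniz a E₁ m ⟩
  conv (∂ a) E₁ m + conv a (∂ E₁) m
    ≡⟨ cong (_+_ (conv (∂ a) E₁ m)) (conv-congʳ a (egfPow-∂ a K) m) ⟩
  conv (∂ a) E₁ m + conv a (λ j → + suc K * conv (∂ a) E₀ j) m
    ≡⟨ cong (_+_ (conv (∂ a) E₁ m)) (conv-*ʳ a (conv (∂ a) E₀) (+ suc K) m) ⟩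
  conv (∂ a) E₁ m + + suc K * conv a (conv (∂ a) E₀) m
    ≡⟨ cong (λ x → conv (∂ a) E₁ m + + suc K * x) (conv-leftComm a (∂ a) E₀ m) ⟩
  conv (∂ a) E₁ m + + suc K * conv (∂ a) E₁ m
    ≡⟨ x+kx≡[1+k]x (conv (∂ a) E₁ m) (+ suc K) ⟩
  + suc (suc K) * conv (∂ a) E₁ m ∎
  where
  open ≡-Reasoning
  E₀ E₁ : ℕ → ℤ
  E₀ = egfPow a K
  E₁ = egfPow a (suc K)
  x+kx≡[1+k]x : ∀ x k → x + k * x ≡ (+ 1 + k) * x
  x+kx≡[1+k]x = solve-∀

-- The EGF A^K/K!, defined through its derivative A′ · A^(K-1)/(K-1)! and vanishing constant term.
dividedPow : (ℕ → ℤ) → ℕ → ℕ → ℤ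
dividedPow a zero    m       = egfPow a zero m
dividedPow a (suc K) zero    = + 0
dividedPow a (suc K) (suc m) = conv (∂ a) (dividedPow a K) m

egfPow≡K!*dividedPow : ∀ a → a 0 ≡ + 0 → ∀ K m → egfPow a K m ≡ + (K !) * dividedPow a K m
egfPow≡K!*dividedPow a a₀≡0 zero m = sym (ℤP.*-identityˡ (egfPow a zero m))
egfPow≡K!*dividedPow a a₀≡0 (suc K) zero =
  trans (cong (λ a₀ → + 0 + + 1 * a₀ * egfPow a K 0) a₀≡0) (sym (ℤP.*-zeroʳ (+ (suc K !))))
egfPow≡K!*dividedPow a a₀≡0 (suc K) (suc m) = begin
  egfPow a (suc K) (suc m)
    ≡⟨ egfPow-∂ a K m ⟩
  + suc K * conv (∂ a) (egfPow a K) m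
    ≡⟨ cong (+ suc K *_) (conv-congʳ (∂ a) (egfPow≡K!*dividedPow a a₀≡0 K) m) ⟩
  + suc K * conv (∂ a) (λ j → + (K !) * B j) m
    ≡⟨ cong (+ suc K *_) (conv-*ʳ (∂ a) B (+ (K !)) m) ⟩
  + suc K * (+ (K !) * conv (∂ a) B m)
    ≡⟨ ℤP.*-assoc (+ suc K) (+ (K !)) (conv (∂ a) B m) ⟨
  + suc K * + (K !) * conv (∂ a) B m
    ≡⟨ cong (_* conv (∂ a) B m) (ℤP.pos-* (suc K) (K !)) ⟨
  + (suc K !) * dividedPow a (suc K) (suc m) ∎
  where
  open ≡-Reasoning
  B : ℕ → ℤ
  B = dividedPow a K

dividedPow-below : ∀ a K m → m < K → dividedPow a K m ≡ + 0
dividedPow-below a (suc K) zero    _     = refl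
dividedPow-below a (suc K) (suc m) m<K = σ-zero (suc m) (λ i _ →
  trans (cong (+ (m C i) * a (suc i) *_)
              (dividedPow-below a K (m ∸ i) (ℕP.≤-<-trans (ℕP.m∸n≤m m i) (ℕP.≤-pred m<K))))
        (ℤP.*-zeroʳ (+ (m C i) * a (suc i))))

dividedPow-diagonal : ∀ a K → dividedPow a K K ≡ a 1 ^ K
dividedPow-diagonal a zero    = refl
dividedPow-diagonal a (suc K) = begin
  conv (∂ a) (dividedPow a K) K                   ≡⟨ σ-head K _ ⟩
  + 1 * a 1 * dividedPow a K K + σ K off-diagonal ≡⟨ cong₂ _+_ (cong (+ 1 * a 1 *_) (dividedPow-diagonal a K))
                                                              (σ-zero K off-diagonal≡0) ⟩
  + 1 * a 1 * a 1 ^ K + + 0                       ≡⟨ simplify (a 1) (a 1 ^ K) ⟩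
  a 1 * a 1 ^ K                                   ∎
  where
  open ≡-Reasoning
  off-diagonal : ℕ → ℤ
  off-diagonal i = + (K C suc i) * a (suc (suc i)) * dividedPow a K (K ∸ suc i)
  off-diagonal≡0 : ∀ i → i < K → off-diagonal i ≡ + 0
  off-diagonal≡0 i i<K =
    trans (cong (+ (K C suc i) * a (suc (suc i)) *_)
                (dividedPow-below a K (K ∸ suc i) (ℕP.∸-monoʳ-< (s≤s z≤n) i<K)))
          (ℤP.*-zeroʳ (+ (K C suc i) * a (suc (suc i))))
  simplify : ∀ x y → + 1 * x * y + + 0 ≡ x * y
  simplify = solve-∀

dividedPow-∣ : ∀ {k} a D → (∀ j → D < j → k ∣ a j) →
  ∀ K m → D ℕ.* K < m → k ∣ dividedPow a K m
dividedPow-∣ a D k∣a zero    (suc m) _       = divides (+ 0) refl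
dividedPow-∣ {k} a D k∣a (suc K) (suc m) D[1+K]<1+m = ∣fᵢ⇒∣σf (suc m) term
  where
  open ℕP.≤-Reasoning
  term : ∀ i → i < suc m → k ∣ + (m C i) * a (suc i) * dividedPow a K (m ∸ i)
  term i _ with D ℕ.<? suc i
  ... | yes D<1+i = ∣m⇒∣m*n (dividedPow a K (m ∸ i)) (∣n⇒∣m*n (+ (m C i)) (k∣a (suc i) D<1+i))
  ... | no  D≮1+i = ∣n⇒∣m*n (+ (m C i) * a (suc i)) (dividedPow-∣ a D k∣a K (m ∸ i) DK<m∸i)
    where
    DK<m∸i : D ℕ.* K < m ∸ i
    DK<m∸i = ℕP.m+n≤o⇒m≤o∸n (suc (D ℕ.* K)) (ℕP.≤-pred (begin-strict
      suc (D ℕ.* K ℕ.+ i)  ≡⟨ ℕP.+-suc (D ℕ.* K) i ⟨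
      D ℕ.* K ℕ.+ suc i    ≤⟨ ℕP.+-monoʳ-≤ (D ℕ.* K) (ℕP.≮⇒≥ D≮1+i) ⟩
      D ℕ.* K ℕ.+ D        ≡⟨ ℕP.+-comm (D ℕ.* K) D ⟩
      D ℕ.+ D ℕ.* K        ≡⟨ ℕP.*-suc D K ⟨
      D ℕ.* suc K          <⟨ D[1+K]<1+m ⟩
      suc m                ∎))

∣fⱼ⇒∣Πf : ∀ {k} (f : ℕ → ℤ) {j} n → 1 ≤ j → j ≤ n → k ∣ f j → k ∣ Π[1to n ] f
∣fⱼ⇒∣Πf f (suc n) 1≤j j≤1+n k∣fj with ℕP.m≤n⇒m<n∨m≡n j≤1+n
... | inj₁ j<1+n = ∣m⇒∣m*n (f (suc n)) (∣fⱼ⇒∣Πf f n 1≤j (ℕP.≤-pred j<1+n) k∣fj)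
... | inj₂ refl  = ∣n⇒∣m*n (Π[1to n ] f) k∣fj
∣fⱼ⇒∣Πf f zero (s≤s _) ()

∣x⇒∣x² : ∀ {k x} → k ∣ x → k ∣ x ^ 2
∣x⇒∣x² {x = x} = ∣m⇒∣m*n (x ^ 1)

∏4j∸1 ∏4j∸3 : ℕ → ℤ
∏4j∸1 n = Π[1to n ] (λ j → + (4 ℕ.* j ∸ 1))
∏4j∸3 n = Π[1to n ] (λ j → + (4 ℕ.* j ∸ 3))

5∣∏4j∸1 : ∀ {n} → 4 ≤ n → + 5 ∣ ∏4j∸1 n
5∣∏4j∸1 4≤n = ∣fⱼ⇒∣Πf _ _ (s≤s z≤n) 4≤n (divides (+ 3) refl)

5∣∏4j∸3 : ∀ {n} → 2 ≤ n → + 5 ∣ ∏4j∸3 n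
5∣∏4j∸3 2≤n = ∣fⱼ⇒∣Πf _ _ (s≤s z≤n) 2≤n (divides (+ 1) refl)

u-suc : ∀ p → u (suc p) ≡ uStep (suc p) u
u-suc = cov-suc uStep (λ p f g f≗g → cong (_-_ (∏4j∸1 (suc p) ^ 2)) (σ-cong (suc p) (λ i i<1+p →
  cong (+ ((2 ℕ.* suc p ℕ.+ 1) C (2 ℕ.* i ℕ.+ 1)) * ∏4j∸3 (suc p ∸ i) ^ 2 *_) (f≗g i i<1+p))))

5∣u : ∀ n → 3 ≤ n → + 5 ∣ u n
5∣u = <-rec _ step
  where
  step : ∀ n → (∀ {m} → m < n → 3 ≤ m → + 5 ∣ u m) → 3 ≤ n → + 5 ∣ u n
  step (suc p) ih (s≤s 2≤p) with ℕP.m≤n⇒m<n∨m≡n 2≤p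
  ... | inj₂ refl = divides (+ 5712) refl
  ... | inj₁ 3≤p  = subst (+ 5 ∣_) (sym (u-suc p))
    (∣m∣n⇒∣m-n (∣x⇒∣x² (5∣∏4j∸1 (s≤s 3≤p))) (∣fᵢ⇒∣σf (suc p) term))
    where
    binomial : ℕ → ℤ
    binomial i = + ((2 ℕ.* suc p ℕ.+ 1) C (2 ℕ.* i ℕ.+ 1))
    term : ∀ i → i < suc p → + 5 ∣ binomial i * ∏4j∸3 (suc p ∸ i) ^ 2 * u i
    term i i<1+p with ℕP.m≤n⇒m<n∨m≡n (ℕP.≤-pred i<1+p)
    ... | inj₂ refl = ∣n⇒∣m*n (binomial p * ∏4j∸3 (suc p ∸ p) ^ 2) (ih ℕP.≤-refl 3≤p)
    ... | inj₁ i<p  = ∣m⇒∣m*n (u i) (∣n⇒∣m*n (binomial i) (∣x⇒∣x² (5∣∏4j∸3 2≤1+p∸i)))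
      where
      2≤1+p∸i : 2 ≤ suc p ∸ i
      2≤1+p∸i = subst (2 ≤_) (sym (ℕP.+-∸-assoc 1 (ℕP.<⇒≤ i<p))) (s≤s (ℕP.m<n⇒0<n∸m i<p))

2∣σ-palindrome : ∀ L (g : ℕ → ℤ) → (∀ i → i < L → g i ≡ g (L ∸ suc i)) →
  (∀ i → i < L → i ≡ L ∸ suc i → + 2 ∣ g i) → + 2 ∣ σ L g
2∣σ-palindrome zero          g _         _      = divides (+ 0) refl
2∣σ-palindrome (suc zero)    g _         middle =
  subst (+ 2 ∣_) (sym (ℤP.+-identityˡ (g 0))) (middle 0 (s≤s z≤n) refl)
2∣σ-palindrome (suc (suc L)) g symmetric middle =
  subst (+ 2 ∣_) (sym σ≡inner+2g₀)
    (∣m∣n⇒∣m+n (2∣σ-palindrome L (λ i → g (suc i)) symmetric′ middle′) (divides (g 0) refl))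
  where
  σ≡inner+2g₀ : σ (suc (suc L)) g ≡ σ L (λ i → g (suc i)) + g 0 * + 2
  σ≡inner+2g₀ = trans (cong₂ _+_ (σ-head L g) (sym (symmetric 0 (s≤s z≤n))))
                      (regroup (g 0) (σ L (λ i → g (suc i))))
    where
    regroup : ∀ x s → x + s + x ≡ s + x * + 2
    regroup = solve-∀
  symmetric′ : ∀ i → i < L → g (suc i) ≡ g (suc (L ∸ suc i))
  symmetric′ i i<L = trans (symmetric (suc i) (ℕP.m<n⇒m<1+n (s≤s i<L))) (cong g (ℕP.+-∸-assoc 1 i<L))
  middle′ : ∀ i → i < L → i ≡ L ∸ suc i → + 2 ∣ g (suc i)
  middle′ i i<L i≡L∸1+i = middle (suc i) (ℕP.m<n⇒m<1+n (s≤s i<L))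
    (trans (cong suc i≡L∸1+i) (sym (ℕP.+-∸-assoc 1 i<L)))

2*[1+k]≡1+k+[1+k] : ∀ k → 2 ℕ.* suc k ≡ suc (k ℕ.+ suc k)
2*[1+k]≡1+k+[1+k] k = cong (λ x → suc (k ℕ.+ x)) (ℕP.+-identityʳ (suc k))

2∣centralBinomial : ∀ k → + 2 ∣ + ((2 ℕ.* suc k) C suc k)
2∣centralBinomial k = divides (+ (N C k)) (begin
  + ((2 ℕ.* suc k) C suc k)  ≡⟨ cong (λ n → + (n C suc k)) (2*[1+k]≡1+k+[1+k] k) ⟩
  + (suc N C suc k)          ≡⟨ cong +_ (nCk+nC[k+1]≡[n+1]C[k+1] N k) ⟨
  + (N C k ℕ.+ N C suc k)    ≡⟨ cong (λ c → + (N C k ℕ.+ c)) NC[1+k]≡NCk ⟩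
  + (N C k ℕ.+ N C k)        ≡⟨ ℤP.pos-+ (N C k) (N C k) ⟩
  + (N C k) + + (N C k)      ≡⟨ x+x≡x*2 (+ (N C k)) ⟩
  + (N C k) * + 2            ∎)
  where
  open ≡-Reasoning
  N : ℕ
  N = k ℕ.+ suc k
  NC[1+k]≡NCk : N C suc k ≡ N C k
  NC[1+k]≡NCk = trans (nCk≡nC[n∸k] (ℕP.m≤n+m (suc k) k)) (cong (N C_) (ℕP.m+n∸n≡m k (suc k)))
  x+x≡x*2 : ∀ x → x + x ≡ x * + 2
  x+x≡x*2 = solve-∀

vSummand : ℕ → ℕ → ℤ
vSummand p i = + ((2 ℕ.* suc p) C (2 ℕ.* suc i)) * v (suc i) * v (p ∸ i)

v-suc : ∀ p → v (suc p) ≡ (+ 2) ^ p * ∏4j∸3 (suc p) ^ 2 - σ p (vSummand p) / + 2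
v-suc = cov-suc vStep (λ p f g f≗g → cong (λ S → (+ 2) ^ p * ∏4j∸3 (suc p) ^ 2 - S / + 2)
  (σ-cong p (λ i i<p → cong₂ (λ x y → + ((2 ℕ.* suc p) C (2 ℕ.* suc i)) * x * y)
    (f≗g (suc i) (s≤s i<p)) (f≗g (p ∸ i) (s≤s (ℕP.m∸n≤m p i))))))

vSummand-symmetric : ∀ p i → i < p → vSummand p i ≡ vSummand p (p ∸ suc i)
vSummand-symmetric p i i<p = begin
  + ((2 ℕ.* suc p) C (2 ℕ.* suc i)) * v (suc i) * v (p ∸ i)
    ≡⟨ cong (λ c → + c * v (suc i) * v (p ∸ i)) binomial-symmetric ⟩
  + ((2 ℕ.* suc p) C (2 ℕ.* (p ∸ i))) * v (suc i) * v (p ∸ i)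
    ≡⟨ xyz≡xzy (+ ((2 ℕ.* suc p) C (2 ℕ.* (p ∸ i)))) (v (suc i)) (v (p ∸ i)) ⟩
  + ((2 ℕ.* suc p) C (2 ℕ.* (p ∸ i))) * v (p ∸ i) * v (suc i)
    ≡⟨ cong₂ (λ s t → + ((2 ℕ.* suc p) C (2 ℕ.* s)) * v s * v t)
             (sym (ℕP.+-∸-assoc 1 i<p)) (ℕP.m∸[m∸n]≡n i<p) ⟨
  vSummand p (p ∸ suc i) ∎
  where
  open ≡-Reasoning
  xyz≡xzy : ∀ x y z → x * y * z ≡ x * z * y
  xyz≡xzy = solve-∀
  binomial-symmetric : (2 ℕ.* suc p) C (2 ℕ.* suc i) ≡ (2 ℕ.* suc p) C (2 ℕ.* (p ∸ i))
  binomial-symmetric = trans (nCk≡nC[n∸k] (ℕP.*-monoʳ-≤ 2 (s≤s (ℕP.<⇒≤ i<p))))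
                             (cong ((2 ℕ.* suc p) C_) (sym (ℕP.*-distribˡ-∸ 2 (suc p) (suc i))))

2∣vSummand-middle : ∀ p i → i < p → i ≡ p ∸ suc i → + 2 ∣ vSummand p i
2∣vSummand-middle p i i<p i≡p∸1+i =
  ∣m⇒∣m*n (v (p ∸ i)) (∣m⇒∣m*n (v (suc i))
    (subst (λ c → + 2 ∣ + ((2 ℕ.* suc p) C c)) (sym 2[1+i]≡1+p) (2∣centralBinomial p)))
  where
  2[1+i]≡1+p : 2 ℕ.* suc i ≡ suc p
  2[1+i]≡1+p = trans (2*[1+k]≡1+k+[1+k] i)
                     (cong suc (trans (cong (ℕ._+ suc i) i≡p∸1+i) (ℕP.m∸n+n≡m i<p)))

5∣2*q⇒5∣q : ∀ {q} → + 5 ∣ + 2 * q → + 5 ∣ q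
5∣2*q⇒5∣q {q} 5∣2q =
  ∣ᵤ⇒∣ (coprime-divisor (+ 5) (+ 2) q (from-yes (coprime? (+ 5) (+ 2))) (∣⇒∣ᵤ 5∣2q))

5∣v : ∀ n → 3 ≤ n → + 5 ∣ v n
5∣v = <-rec _ step
  where
  step : ∀ n → (∀ {m} → m < n → 3 ≤ m → + 5 ∣ v m) → 3 ≤ n → + 5 ∣ v n
  step (suc p) ih (s≤s 2≤p) with ℕP.m≤n⇒m<n∨m≡n 2≤p
  ... | inj₂ refl = divides (+ 1479) refl
  ... | inj₁ 3≤p with ℕP.m≤n⇒m<n∨m≡n 3≤p
  ...   | inj₂ refl = divides (+ 490685) refl
  ...   | inj₁ 4≤p  = subst (+ 5 ∣_) (sym (v-suc p))
    (∣m∣n⇒∣m-n (∣n⇒∣m*n ((+ 2) ^ p) (∣x⇒∣x² (5∣∏4j∸3 2≤1+p)))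
               (subst (+ 5 ∣_) (sym S/2≡q) (5∣2*q⇒5∣q (subst (+ 5 ∣_) S≡2q 5∣S))))
    where
    2≤1+p : 2 ≤ suc p
    2≤1+p = ℕP.≤-trans (s≤s (s≤s z≤n)) (ℕP.m≤n⇒m≤1+n 4≤p)
    S : ℤ
    S = σ p (vSummand p)
    -- `/` rounds down, so S has to be shown even before divisibility by 5 passes to S / 2.
    2∣S : + 2 ∣ S
    2∣S = 2∣σ-palindrome p (vSummand p) (vSummand-symmetric p) (2∣vSummand-middle p)
    q : ℤ
    q = _∣_.quotient 2∣S
    S≡2q : S ≡ + 2 * q
    S≡2q = trans (_∣_.equality 2∣S) (ℤP.*-comm q (+ 2))
    S/2≡q : S / + 2 ≡ q
    S/2≡q = trans (cong (λ x → x / + 2) S≡2q) (m*n/m≡n 2 q)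
    binomial : ℕ → ℤ
    binomial i = + ((2 ℕ.* suc p) C (2 ℕ.* suc i))
    term : ∀ i → i < p → + 5 ∣ vSummand p i
    term i i<p with 3 ℕ.≤? suc i
    ... | yes 3≤1+i = ∣m⇒∣m*n (v (p ∸ i)) (∣n⇒∣m*n (binomial i) (ih (s≤s i<p) 3≤1+i))
    ... | no  3≰1+i = ∣n⇒∣m*n (binomial i * v (suc i)) (ih (s≤s (ℕP.m∸n≤m p i)) 3≤p∸i)
      where
      i≤1 : i ≤ 1
      i≤1 = ℕP.≤-pred (ℕP.≤-pred (ℕP.≰⇒> 3≰1+i))
      3≤p∸i : 3 ≤ p ∸ i
      3≤p∸i = ℕP.≤-trans (ℕP.∸-monoˡ-≤ 1 4≤p) (ℕP.∸-monoʳ-≤ p i≤1)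
    5∣S : + 5 ∣ S
    5∣S = ∣fᵢ⇒∣σf p term

5∣Ucoef : ∀ j → 5 < j → + 5 ∣ Ucoef j
5∣Ucoef j 5<j with j ℕ.% 2 ℕ.≡ᵇ 0
... | true  = divides (+ 0) refl
... | false = 5∣u (j ℕ./ 2) (/-monoˡ-≤ 2 5<j)

s≡dividedPow : ∀ n k → s n k ≡ dividedPow Ucoef (2 ℕ.* k) (2 ℕ.* n)
s≡dividedPow n k =
  trans (cong (λ e → _/_ e (+ ((2 ℕ.* k) !)) {{ℕP._!≢0 (2 ℕ.* k)}})
              (egfPow≡K!*dividedPow Ucoef refl (2 ℕ.* k) (2 ℕ.* n)))
        (m*n/m≡n ((2 ℕ.* k) !) _ {{ℕP._!≢0 (2 ℕ.* k)}})

r-diagonal : ∀ n → r n n ≡ + 1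
r-diagonal n = begin
  (+ 2) ^ (n ∸ n) * s n n
    ≡⟨ cong₂ (λ e x → (+ 2) ^ e * x) (ℕP.n∸n≡0 n) (s≡dividedPow n n) ⟩
  + 1 * dividedPow Ucoef (2 ℕ.* n) (2 ℕ.* n)   ≡⟨ ℤP.*-identityˡ _ ⟩
  dividedPow Ucoef (2 ℕ.* n) (2 ℕ.* n)         ≡⟨ dividedPow-diagonal Ucoef (2 ℕ.* n) ⟩
  (+ 1) ^ (2 ℕ.* n)                            ≡⟨ ℤP.^-zeroˡ (2 ℕ.* n) ⟩
  + 1                                          ∎
  where open ≡-Reasoning

5∣r : ∀ n k → 5 ℕ.* k < n → + 5 ∣ r n k
5∣r n k 5k<n = ∣n⇒∣m*n ((+ 2) ^ (n ∸ k)) (subst (+ 5 ∣_) (sym (s≡dividedPow n k))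
  (dividedPow-∣ Ucoef 5 5∣Ucoef (2 ℕ.* k) (2 ℕ.* n) 5[2k]<2n))
  where
  5[2k]<2n : 5 ℕ.* (2 ℕ.* k) < 2 ℕ.* n
  5[2k]<2n = subst (_< 2 ℕ.* n) (trans (sym (ℕP.*-assoc 2 5 k)) (ℕP.*-assoc 5 2 k)) (ℕP.*-monoʳ-< 2 5k<n)

alt : ℕ → ℤ
alt k = -[1+ 0 ] ^ suc k

alt-suc-suc : ∀ k → alt (suc (suc k)) ≡ alt k
alt-suc-suc k = [-1]*[-1]*x≡x (alt k)
  where
  [-1]*[-1]*x≡x : ∀ x → -[1+ 0 ] * (-[1+ 0 ] * x) ≡ x
  [-1]*[-1]*x≡x = solve-∀

alt-parity : ∀ k → (k ℕ.% 2 ≡ 0 × alt k ≡ -[1+ 0 ]) ⊎ (k ℕ.% 2 ≡ 1 × alt k ≡ + 1)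
alt-parity zero          = inj₁ (refl , refl)
alt-parity (suc zero)    = inj₂ (refl , refl)
alt-parity (suc (suc k)) rewrite alt-suc-suc k = alt-parity k

paritySummand : ℕ → ℕ → ℕ → ℤ
paritySummand e n k = if (n ≤ᵇ 5 ℕ.* k) ∧ (k ℕ.% 2 ℕ.≡ᵇ e) then r n k else + 0

5∣alternating-paritySummand : ∀ n k → + 5 ∣ r n k * alt k + paritySummand 0 n k - paritySummand 1 n k
5∣alternating-paritySummand n k with n ≤ᵇ 5 ℕ.* k | ℕP.≤ᵇ-reflects-≤ n (5 ℕ.* k)
... | false | ofⁿ n≰5k =
  subst (+ 5 ∣_) (sym (x+0-0≡x (r n k * alt k))) (∣m⇒∣m*n (alt k) (5∣r n k (ℕP.≰⇒> n≰5k)))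
  where
  x+0-0≡x : ∀ x → x + + 0 - + 0 ≡ x
  x+0-0≡x = solve-∀
... | true  | _ with alt-parity k
...   | inj₁ (k%2≡0 , alt≡-1) rewrite k%2≡0 | alt≡-1 = divides (+ 0) (cancel (r n k))
  where
  cancel : ∀ x → x * -[1+ 0 ] + x - + 0 ≡ + 0
  cancel = solve-∀
...   | inj₂ (k%2≡1 , alt≡1)  rewrite k%2≡1 | alt≡1  = divides (+ 0) (cancel (r n k))
  where
  cancel : ∀ x → x * + 1 + + 0 - x ≡ + 0
  cancel = solve-∀

5∣alternatingRow : ∀ n → (rParitySum 0 n ≡ + 0 [mod5]) × (rParitySum 1 n ≡ + 0 [mod5]) →
  + 5 ∣ σ (suc n) (λ k → r n k * alt k)
5∣alternatingRow n (even≡0 , odd≡0) =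
  ∣m+n∣n⇒∣m (∣m+n∣n⇒∣m 5∣row+even-odd (∣m⇒∣-m (from-mod5 odd≡0))) (from-mod5 even≡0)
  where
  from-mod5 : ∀ {x} → x ≡ + 0 [mod5] → + 5 ∣ x
  from-mod5 {x} x≡0 = subst (+ 5 ∣_) (ℤP.+-identityʳ x) (∣ᵤ⇒∣ x≡0)
  5∣row+even-odd : + 5 ∣ σ (suc n) (λ k → r n k * alt k) + rParitySum 0 n - rParitySum 1 n
  5∣row+even-odd = subst (λ x → + 5 ∣ x - rParitySum 1 n) (σ-distrib-+ (suc n) _ (paritySummand 0 n))
    (∣fᵢ-gᵢ⇒∣σf-σg (suc n) (λ k _ → 5∣alternating-paritySummand n k))

5∣interiorAlternatingRow : ∀ p → + 5 ∣ σ (suc (suc p)) (λ k → r (suc p) k * alt k) →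
  + 5 ∣ σ p (λ i → r (suc p) (suc i) * alt (suc i)) + alt (suc p)
5∣interiorAlternatingRow p 5∣row = ∣m+n∣m⇒∣n (subst (+ 5 ∣_) row≡first+interior 5∣row) 5∣first
  where
  n : ℕ
  n = suc p
  w : ℕ → ℤ
  w k = r n k * alt k
  5∣first : + 5 ∣ w 0
  5∣first = ∣m⇒∣m*n (alt 0) (5∣r n 0 (s≤s z≤n))
  row≡first+interior : σ (suc n) w ≡ w 0 + (σ p (λ i → w (suc i)) + alt n)
  row≡first+interior = begin
    σ (suc p) w + r n n * alt n
      ≡⟨ cong₂ _+_ (σ-head p w) (cong (_* alt n) (r-diagonal n)) ⟩
    w 0 + σ p (λ i → w (suc i)) + + 1 * alt n      ≡⟨ regroup (w 0) (σ p (λ i → w (suc i))) (alt n) ⟩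
    w 0 + (σ p (λ i → w (suc i)) + alt n)          ∎
    where
    open ≡-Reasoning
    regroup : ∀ x y z → x + y + + 1 * z ≡ x + (y + z)
    regroup = solve-∀

d-suc : ∀ p → d (suc p) ≡ v (suc p) - σ p (λ i → r (suc p) (suc i) * d (suc i))
d-suc = cov-suc dStep (λ p f g f≗g →
  cong (_-_ (v (suc p))) (σ-cong p (λ i i<p → cong (r (suc p) (suc i) *_) (f≗g (suc i) (s≤s i<p)))))

5∣d-alt : (∀ n → 3 ≤ n → + 5 ∣ σ (suc n) (λ k → r n k * alt k)) →
  ∀ n → 1 ≤ n → + 5 ∣ d n - alt n
5∣d-alt 5∣row = <-rec _ step
  where
  step : ∀ n → (∀ {m} → m < n → 1 ≤ m → + 5 ∣ d m - alt m) → 1 ≤ n → + 5 ∣ d n - alt n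
  step 1 _ _ = divides (+ 0) refl
  step 2 _ _ = divides (+ 0) refl
  step (suc p@(suc (suc _))) ih _ =
    subst (+ 5 ∣_) (sym d-alt≡) (∣m∣n⇒∣m-n (∣m∣n⇒∣m-n (5∣v n 3≤n) 5∣R-W) 5∣W+alt)
    where
    n : ℕ
    n = suc p
    3≤n : 3 ≤ n
    3≤n = s≤s (s≤s (s≤s z≤n))
    R W : ℤ
    R = σ p (λ i → r n (suc i) * d (suc i))
    W = σ p (λ i → r n (suc i) * alt (suc i))
    5∣W+alt : + 5 ∣ W + alt n
    5∣W+alt = 5∣interiorAlternatingRow p (5∣row n 3≤n)
    5∣R-W : + 5 ∣ R - W
    5∣R-W = ∣fᵢ-gᵢ⇒∣σf-σg p (λ i i<p →
      subst (+ 5 ∣_) (x[y-z]≡xy-xz (r n (suc i)) (d (suc i)) (alt (suc i)))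
            (∣n⇒∣m*n (r n (suc i)) (ih (s≤s i<p) (s≤s z≤n))))
      where
      x[y-z]≡xy-xz : ∀ x y z → x * (y - z) ≡ x * y - x * z
      x[y-z]≡xy-xz = solve-∀
    d-alt≡ : d n - alt n ≡ v n - (R - W) - (W + alt n)
    d-alt≡ = trans (cong (_- alt n) (d-suc p)) (regroup (v n) R W (alt n))
      where
      regroup : ∀ x y z t → x - y - t ≡ x - (y - z) - (z + t)
      regroup = solve-∀

lemma14 : (∀ (n : ℕ) → 3 ≤ n →
    (rParitySum 0 n ≡ + 0 [mod5]) × (rParitySum 1 n ≡ + 0 [mod5])) →
    ∀ (n : ℕ) → 1 ≤ n → d n ≡ -[1+ 0 ] ^ (suc n) [mod5]
lemma14 hyp n 1≤n = ∣⇒∣ᵤ (5∣d-alt (λ m 3≤m → 5∣alternatingRow m (hyp m 3≤m)) n 1≤n)
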